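{- For every $n\ge4$, the number of coherent lattice paths of size $n$ (equivalently, of coherent monotone paths on the hypersimplex $\Delta(n,2)$ for a generic direction, i.e. of vertices of its monotone path polytope) is $\frac13\bigl(25\cdot 4^{\,n-4}-1\bigr)$.
   Context: A diagonal-avoiding lattice path of size $n$ (dimension 2) is a sequence of points $\boldsymbol\ell_1,\dots,\boldsymbol\ell_r\in[n]^2$ with $\boldsymbol\ell_1=(2,1)$, $\boldsymbol\ell_r\in\{(n-1,n),(n,n-1)\}$, the two coordinates of each point distinct, and consecutive points differing in exactly one coordinate, which strictly increases. Its $i$-th enhanced step is $(a\to b;z)$ where the changing coordinate goes from $a$ to $b$ and the fixed coordinate equals $z$; $\prec$ denotes the order of steps along the path. It is a coherent lattice path if for all enhanced steps $(i\to j;a)\prec(x\to y;z)$ with $x<j$ one has $j=z$ or $x=a$. Here $\Delta(n,2)=\{\mathbf x\in[0,1]^n:\sum x_i=2\}$, a generic direction is $\mathbf c$ with pairwise distinct coordinates, and a monotone path is coherent if some $\boldsymbol\omega\in\mathbb R^n$ makes its edges exactly the preimages of the upper edges of the polygon $\{(\langle\mathbf x,\mathbf c\rangle,\langle\mathbf x,\boldsymbol\omega\rangle):\mathbf x\in\Delta(n,2)\}$. -}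

module Defs where

open import Data.Nat using (ℕ; _<_; _≤_; _∸_; _≟_)
open import Data.Product using (_×_; _,_; proj₁; proj₂; ∃; ∃-syntax)
open import Data.Sum using (_⊎_)
open import Data.List using (List; []; _∷_; _++_; head; last)
open import Data.List.Relation.Unary.All using (All)
open import Data.List.Relation.Unary.Linked using (Linked)
open import Data.Maybe using (Maybe; just)
open import Relation.Nullary using (¬_; yes; no)
open import Relation.Binary.PropositionalEquality using (_≡_; _≢_)

Point : Set
Point = ℕ × ℕ

GoodPoint : ℕ → Point → Set
GoodPoint n (x , y) = (1 ≤ x × x ≤ n) × (1 ≤ y × y ≤ n) × x ≢ y

ValidMove : Point → Point → Set
ValidMove (x , y) (x' , y') = (x < x' × y ≡ y') ⊎ (x ≡ x' × y < y')

record Step : Set where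
  constructor step
  field
    src   : ℕ
    tgt   : ℕ
    fixed : ℕ

stepOf : Point → Point → Step
stepOf (x , y) (x' , y') with x ≟ x'
... | yes _ = step y y' x
... | no  _ = step x x' y

steps : List Point → List Step
steps (p ∷ q ∷ rest) = stepOf p q ∷ steps (q ∷ rest)
steps _ = []

Precedes : List Step → Step → Step → Set
Precedes ss s t = ∃[ xs ] ∃[ ys ] ∃[ zs ] ss ≡ xs ++ (s ∷ ys ++ (t ∷ zs))

LatticePath : ℕ → List Point → Set
LatticePath n ps =
  head ps ≡ just (2 , 1) ×
  (last ps ≡ just (n ∸ 1 , n) ⊎ last ps ≡ just (n , n ∸ 1)) ×
  All (GoodPoint n) ps ×
  Linked ValidMove ps

Coherent : List Point → Set
Coherent ps = ∀ i j a x y z →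
  Precedes (steps ps) (step i j a) (step x y z) →
  x < j → (j ≡ z ⊎ x ≡ a)

CoherentLatticePath : ℕ → List Point → Set
CoherentLatticePath n ps = LatticePath n ps × Coherent ps

{-# OPTIONS --safe #-}
module Submission where

-- At a point whose coordinates are p < q, a lattice path can raise q, let p overtake q, or
-- advance p to some y < q. Which later steps are still compatible with all earlier ones
-- depends only on p, q, a threshold m (p may only advance to values ≥ m) and a mode: after
-- an advance, p can only ever move with fixed coordinate q, so raising q would strand p
-- and is excluded. Following these rules enumerates every coherent lattice path exactly
-- once, and the number of continuations obeys linear recurrences in a = n ∸ q and b = q ∸ m,
-- whose solution gives 8 + 25 (4 ^ t ∸ 1) / 3 paths of size t + 4.

open import Defs
open import Data.Bool using (Bool; true; false; not)
open import Data.Empty using (⊥; ⊥-elim)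
open import Data.List using (List; []; _∷_; [_]; _++_; map; length; last)
open import Data.List.Properties using (length-map; length-++; ∷-injectiveʳ)
open import Data.List.Membership.Propositional using (_∈_)
open import Data.List.Membership.Propositional.Properties using (∈-++⁻; ∈-++⁺ˡ; ∈-++⁺ʳ; ∈-map⁻; ∈-map⁺; ∈-∃++)
open import Data.List.Relation.Binary.Disjoint.Propositional using (Disjoint)
open import Data.List.Relation.Unary.All as All using (All; []; _∷_)
import Data.List.Relation.Unary.All.Properties as All
open import Data.List.Relation.Unary.AllPairs using ([]; _∷_)
open import Data.List.Relation.Unary.Any using (here; there)
open import Data.List.Relation.Unary.Linked using (Linked; [-]; _∷_)
open import Data.List.Relation.Unary.Unique.Propositional using (Unique)
import Data.List.Relation.Unary.Unique.Propositional.Properties as Unique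
open import Data.Maybe using (just)
open import Data.Maybe.Properties using (just-injective)
open import Data.Nat using (ℕ; zero; suc; z≤n; s≤s; _+_; _*_; _^_; _∸_; _⊓_; _⊔_; _≤_; _<_; _≟_; _≤?_)
open import Data.Nat.Properties
open import Data.Nat.Tactic.RingSolver using (solve-∀)
open import Data.Product using (Σ; _×_; _,_; proj₁; proj₂; ∃-syntax)
open import Data.Sum as Sum using (_⊎_; inj₁; inj₂)
open import Data.Unit using (⊤; tt)
open import Function using (_∘_)
open import Function.Bundles using (_⇔_; mk⇔; Equivalence)
open import Relation.Binary.Definitions using (tri<; tri≈; tri>)
open import Relation.Binary.PropositionalEquality
  using (_≡_; _≢_; refl; sym; trans; cong; cong₂; subst; module ≡-Reasoning)
open import Relation.Nullary using (¬_; yes; no)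

module _ {A : Set} (R : A → A → Set) where

  -- R s t for every t of ts and every s before it, where pre (most recent first) precedes ts.
  AllPrior : List A → List A → Set
  AllPrior pre []       = ⊤
  AllPrior pre (t ∷ ts) = All (λ s → R s t) pre × AllPrior (t ∷ pre) ts

  allPrior-∈ : ∀ {pre ts s t} → AllPrior pre ts → s ∈ pre → t ∈ ts → R s t
  allPrior-∈ {ts = _ ∷ _} (Rt , _)    s∈ (here refl) = All.lookup Rt s∈
  allPrior-∈ {ts = _ ∷ _} (_ , prior) s∈ (there t∈)  = allPrior-∈ prior (there s∈) t∈

  allPrior-ordered : ∀ {pre} xs {s ys t zs} → AllPrior pre (xs ++ s ∷ ys ++ t ∷ zs) → R s t
  allPrior-ordered []       {ys = ys} (_ , prior) = allPrior-∈ prior (here refl) (∈-++⁺ʳ ys (here refl))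
  allPrior-ordered (_ ∷ xs)           (_ , prior) = allPrior-ordered xs prior

  allPrior-intro : ∀ pre ts → (∀ {xs s ys t zs} → ts ≡ xs ++ s ∷ ys ++ t ∷ zs → R s t) →
                   (∀ {s t} → s ∈ pre → t ∈ ts → R s t) → AllPrior pre ts
  allPrior-intro pre []       ordered across = tt
  allPrior-intro pre (t ∷ ts) ordered across =
    All.tabulate (λ s∈ → across s∈ (here refl)) ,
    allPrior-intro (t ∷ pre) ts (λ {xs} eq → ordered {t ∷ xs} (cong (t ∷_) eq)) across′
    where
      across′ : ∀ {s u} → s ∈ t ∷ pre → u ∈ ts → R s u
      across′ (here refl) u∈ with ∈-∃++ u∈
      ... | ys , zs , ts≡ = ordered {[]} (cong (t ∷_) ts≡)
      across′ (there s∈)  u∈ = across s∈ (there u∈)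

StartsWith : {A : Set} → (A → Set) → List A → Set
StartsWith P []      = ⊥
StartsWith P (x ∷ _) = P x

all-startsWith-map : {A : Set} {P Q : A → Set} {xs : List (List A)} →
                     All (StartsWith P) xs → (∀ {x} → P x → Q x) → All (StartsWith Q) xs
all-startsWith-map {P = P} {Q} Ps f = All.map (λ {v} → weaken {v}) Ps
  where
    weaken : ∀ {v} → StartsWith P v → StartsWith Q v
    weaken {_ ∷ _} = f

disjoint-by-start : {A : Set} {P Q : A → Set} {xs ys : List (List A)} →
                    All (StartsWith P) xs → All (StartsWith Q) ys → (∀ {x} → P x → ¬ Q x) → Disjoint xs ys
disjoint-by-start {P = P} {Q} Ps Qs P⇒¬Q {v} (v∈xs , v∈ys) = separate {v} (All.lookup Ps v∈xs) (All.lookup Qs v∈ys)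
  where
    separate : ∀ {v} → StartsWith P v → ¬ StartsWith Q v
    separate {_ ∷ _} = P⇒¬Q

disjoint-++ʳ : {A : Set} {xs ys zs : List A} → Disjoint xs ys → Disjoint xs zs → Disjoint xs (ys ++ zs)
disjoint-++ʳ {ys = ys} xs#ys xs#zs (v∈xs , v∈ys++zs) with ∈-++⁻ ys v∈ys++zs
... | inj₁ v∈ys = xs#ys (v∈xs , v∈ys)
... | inj₂ v∈zs = xs#zs (v∈xs , v∈zs)

length-++₄ : {A : Set} (xs ys zs ws : List A) →
             length (xs ++ ys ++ zs ++ ws) ≡ length xs + (length ys + (length zs + length ws))
length-++₄ xs ys zs ws = begin
  length (xs ++ ys ++ zs ++ ws)                     ≡⟨ length-++ xs ⟩
  length xs + length (ys ++ zs ++ ws)               ≡⟨ cong (length xs +_) (length-++ ys) ⟩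
  length xs + (length ys + length (zs ++ ws))       ≡⟨ cong (λ k → length xs + (length ys + k)) (length-++ zs) ⟩
  length xs + (length ys + (length zs + length ws)) ∎
  where open ≡-Reasoning

point : Bool → ℕ → ℕ → Point
point true  p q = p , q
point false p q = q , p

unorient : Point → ℕ × ℕ
unorient (x , y) = x ⊓ y , x ⊔ y

unorient-point : ∀ o {p q} → p ≤ q → unorient (point o p q) ≡ (p , q)
unorient-point true  p≤q = cong₂ _,_ (m≤n⇒m⊓n≡m p≤q) (m≤n⇒m⊔n≡n p≤q)
unorient-point false p≤q = cong₂ _,_ (m≥n⇒m⊓n≡n p≤q) (m≥n⇒m⊔n≡m p≤q)

point-injective : ∀ o o′ {p q p′ q′} → p ≤ q → p′ ≤ q′ → point o p q ≡ point o′ p′ q′ → p ≡ p′ × q ≡ q′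
point-injective o o′ p≤q p′≤q′ eq
  with trans (sym (unorient-point o p≤q)) (trans (cong unorient eq) (unorient-point o′ p′≤q′))
... | refl = refl , refl

Above : Bool → ℕ → ℕ → Point → Set
Above o p q x = ∃[ y ] q < y × x ≡ point o p y

Below : Bool → ℕ → ℕ → Point → Set
Below o y₀ q x = ∃[ y ] y₀ ≤ y × y < q × x ≡ point o y q

above-disjoint-above : ∀ {o o′ p q x} → p < q → Above o p q x → ¬ Above o′ q q x
above-disjoint-above {o} {o′} p<q (y , q<y , refl) (y′ , q<y′ , eq) =
  <⇒≢ p<q (proj₁ (point-injective o o′ (<⇒≤ (<-trans p<q q<y)) (<⇒≤ q<y′) eq))

above-disjoint-below : ∀ {o o′ p q y₀ x} → p ≤ q → Above o p q x → ¬ Below o′ y₀ q x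
above-disjoint-below {o} {o′} p≤q (y , q<y , refl) (y′ , _ , y′<q , eq) =
  <⇒≢ q<y (sym (proj₂ (point-injective o o′ (≤-trans p≤q (<⇒≤ q<y)) (<⇒≤ y′<q) eq)))

Allows : Step → ℕ → ℕ → Set
Allows (step i j a) x z = x < j → j ≡ z ⊎ x ≡ a

Allowed : List Step → ℕ → ℕ → Set
Allowed pre x z = All (λ s → Allows s x z) pre

allows-past : ∀ {x z} s → Step.tgt s ≤ x → Allows s x z
allows-past s j≤x x<j = ⊥-elim (≤⇒≯ j≤x x<j)

Compatible : Step → Step → Set
Compatible s t = Allows s (Step.src t) (Step.fixed t)

coherent⇒allPrior : ∀ ps → Coherent ps → AllPrior Compatible [] (steps ps)
coherent⇒allPrior ps coh =
  allPrior-intro Compatible [] (steps ps) (λ {xs} {_} {ys} {_} {zs} eq → coh _ _ _ _ _ _ (xs , ys , zs , eq)) λ ()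

allPrior⇒coherent : ∀ ps → AllPrior Compatible [] (steps ps) → Coherent ps
allPrior⇒coherent ps prior i j a x y z (xs , ys , zs , eq) =
  allPrior-ordered Compatible xs (subst (AllPrior Compatible []) eq prior)

Blocked : List Step → ℕ → ℕ → Set
Blocked pre p q = ∀ z → q ≤ z → ¬ Allowed pre p z

blocked-∷ : ∀ {pre p q y} s → q ≤ y → Blocked pre p q → Blocked (s ∷ pre) p y
blocked-∷ s q≤y blocked z y≤z (_ ∷ φ) = blocked z (≤-trans q≤y y≤z) φ

data Mode : Set where
  free locked : Mode

ifFree : {A : Set} → Mode → A → A → A
ifFree free   x _ = x
ifFree locked _ y = y

ifFree-natural : {A B : Set} (μ : Mode) (f : A → B) (x y : A) → f (ifFree μ x y) ≡ ifFree μ (f x) (f y)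
ifFree-natural free   f x y = refl
ifFree-natural locked f x y = refl

all-ifFree : {A : Set} {P : A → Set} {xs : List A} (μ : Mode) → All P xs → All P (ifFree μ xs [])
all-ifFree free   Ps = Ps
all-ifFree locked _  = []

unique-ifFree : {A : Set} {xs : List A} (μ : Mode) → Unique xs → Unique (ifFree μ xs [])
unique-ifFree free   u = u
unique-ifFree locked _ = []

SmallBeyond : Mode → List Step → ℕ → ℕ → Set
SmallBeyond free   pre p q = ∀ z → q < z → Allowed pre p z
SmallBeyond locked pre p q = ∀ z → q < z → ¬ Allowed pre p z

-- Which later steps pre allows at a point with coordinates p < q. The threshold m, below which p
-- can no longer advance, is the previous value of q if q was raised since p last moved, else p + 1.
record Invariant (μ : Mode) (p q m : ℕ) (pre : List Step) : Set where
  field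
    large       : ∀ x z → q ≤ x → Allowed pre x z
    small       : Allowed pre p q
    smallBeyond : SmallBeyond μ pre p q
    middle⇒     : ∀ x z → p < x → x < q → q ≤ z → Allowed pre x z → m ≤ x × z ≡ q
    middle⇐     : ∀ x → p < x → x < q → m ≤ x → Allowed pre x q

invariant-start : Invariant free 1 2 2 []
invariant-start = record
  { large       = λ _ _ _ → []
  ; small       = []
  ; smallBeyond = λ _ _ → []
  ; middle⇒     = λ x z 1<x x<2 → ⊥-elim (<⇒≱ x<2 1<x)
  ; middle⇐     = λ x 1<x x<2 → ⊥-elim (<⇒≱ x<2 1<x)
  }

invariant-raise : ∀ {p q m y pre} → Invariant free p q m pre → p < q → q < y →
                  Invariant free p y q (step q y p ∷ pre)
invariant-raise {p} {q} {m} {y} {pre} I p<q q<y = record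
  { large       = λ x z y≤x → allows-past (step q y p) y≤x ∷ large x z (≤-trans (<⇒≤ q<y) y≤x)
  ; small       = (λ _ → inj₁ refl) ∷ smallBeyond y q<y
  ; smallBeyond = λ z y<z → (λ _ → inj₂ refl) ∷ smallBeyond z (<-trans q<y y<z)
  ; middle⇒     = middle⇒′
  ; middle⇐     = λ x p<x x<y q≤x → (λ _ → inj₁ refl) ∷ large x y q≤x
  }
  where
    open Invariant I
    middle⇒′ : ∀ x z → p < x → x < y → y ≤ z → Allowed (step q y p ∷ pre) x z → q ≤ x × z ≡ y
    middle⇒′ x z p<x x<y y≤z (allows ∷ φ) with q ≤? x
    ... | no q≰x =
      ⊥-elim (<⇒≢ (<-≤-trans q<y y≤z) (sym (proj₂ (middle⇒ x z p<x (≰⇒> q≰x) (≤-trans (<⇒≤ q<y) y≤z) φ))))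
    ... | yes q≤x with allows x<y
    ...   | inj₁ y≡z = q≤x , sym y≡z
    ...   | inj₂ x≡p = ⊥-elim (>⇒≢ p<x x≡p)

invariant-overtake : ∀ {μ p q m y pre} → Invariant μ p q m pre → q < y →
                     Invariant free q y (suc q) (step p y q ∷ pre)
invariant-overtake {μ} {p} {q} {m} {y} {pre} I q<y = record
  { large       = λ x z y≤x → allows-past (step p y q) y≤x ∷ large x z (≤-trans (<⇒≤ q<y) y≤x)
  ; small       = (λ _ → inj₂ refl) ∷ large q y ≤-refl
  ; smallBeyond = λ z _ → (λ _ → inj₂ refl) ∷ large q z ≤-refl
  ; middle⇒     = middle⇒′
  ; middle⇐     = λ x q<x x<y _ → (λ _ → inj₁ refl) ∷ large x y (<⇒≤ q<x)
  }
  where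
    open Invariant I
    middle⇒′ : ∀ x z → q < x → x < y → y ≤ z → Allowed (step p y q ∷ pre) x z → suc q ≤ x × z ≡ y
    middle⇒′ x z q<x x<y y≤z (allows ∷ _) with allows x<y
    ... | inj₁ y≡z = q<x , sym y≡z
    ... | inj₂ x≡q = ⊥-elim (>⇒≢ q<x x≡q)

invariant-advance : ∀ {μ p q m y pre} → Invariant μ p q m pre → p < y → y < q → m ≤ y →
                    Invariant locked y q (suc y) (step p y q ∷ pre)
invariant-advance {μ} {p} {q} {m} {y} {pre} I p<y y<q m≤y = record
  { large       = λ x z q≤x → allows-past (step p y q) (≤-trans (<⇒≤ y<q) q≤x) ∷ large x z q≤x
  ; small       = allows-past (step p y q) ≤-refl ∷ middle⇐ y p<y y<q m≤y
  ; smallBeyond = λ { z q<z (_ ∷ φ) → <⇒≢ q<z (sym (proj₂ (middle⇒ y z p<y y<q (<⇒≤ q<z) φ))) }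
  ; middle⇒     = λ { x z y<x x<q q≤z (_ ∷ φ) → y<x , proj₂ (middle⇒ x z (<-trans p<y y<x) x<q q≤z φ) }
  ; middle⇐     = λ x y<x x<q _ →
                    allows-past (step p y q) (<⇒≤ y<x) ∷ middle⇐ x (<-trans p<y y<x) x<q (≤-trans m≤y (<⇒≤ y<x))
  }
  where open Invariant I

blocked-advance : ∀ {μ p q m y pre} → Invariant μ p q m pre → p < y → y < q → y < m →
                  Blocked (step p y q ∷ pre) y q
blocked-advance I p<y y<q y<m z q≤z (_ ∷ φ) = <⇒≱ y<m (proj₁ (Invariant.middle⇒ I _ z p<y y<q q≤z φ))

blocked-raise : ∀ {p q m y pre} → Invariant locked p q m pre → q < y → Blocked (step q y p ∷ pre) p y
blocked-raise I q<y z y≤z (_ ∷ φ) = Invariant.smallBeyond I z (<-≤-trans q<y y≤z) φ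

data Move (o : Bool) (p q : ℕ) : Point → Set where
  raise    : ∀ {y} → q < y → Move o p q (point o p y)
  overtake : ∀ {y} → q < y → Move o p q (point (not o) q y)
  advance  : ∀ {y} → p < y → y < q → Move o p q (point o y q)

move : ∀ o {p q x} → p < q → ValidMove (point o p q) x → proj₁ x ≢ proj₂ x → Move o p q x
move true  {p} {q} {x′ , .q} p<q (inj₁ (p<x′ , refl)) x′≢q with <-cmp x′ q
... | tri< x′<q _ _ = advance p<x′ x′<q
... | tri≈ _ x′≡q _ = ⊥-elim (x′≢q x′≡q)
... | tri> _ _ q<x′ = overtake q<x′
move true  {p} {q} {.p , y′} p<q (inj₂ (refl , q<y′)) _ = raise q<y′
move false {p} {q} {x′ , .p} p<q (inj₁ (q<x′ , refl)) _ = raise q<x′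
move false {p} {q} {.q , y′} p<q (inj₂ (refl , p<y′)) q≢y′ with <-cmp y′ q
... | tri< y′<q _ _ = advance p<y′ y′<q
... | tri≈ _ y′≡q _ = ⊥-elim (q≢y′ (sym y′≡q))
... | tri> _ _ q<y′ = overtake q<y′

validMove : ∀ o {p q x} → p < q → Move o p q x → ValidMove (point o p q) x
validMove true  p<q (raise q<y)     = inj₂ (refl , q<y)
validMove false p<q (raise q<y)     = inj₁ (q<y , refl)
validMove true  p<q (overtake q<y)  = inj₁ (<-trans p<q q<y , refl)
validMove false p<q (overtake q<y)  = inj₂ (refl , <-trans p<q q<y)
validMove true  p<q (advance p<y _) = inj₁ (p<y , refl)
validMove false p<q (advance p<y _) = inj₂ (refl , p<y)

moveStep : ∀ {o p q x} → Move o p q x → Step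
moveStep {p = p} {q} (raise {y} _)     = step q y p
moveStep {p = p} {q} (overtake {y} _)  = step p y q
moveStep {p = p} {q} (advance {y} _ _) = step p y q

stepOf-vertical : ∀ x y y′ → stepOf (x , y) (x , y′) ≡ step y y′ x
stepOf-vertical x y y′ with x ≟ x
... | yes _   = refl
... | no  x≢x = ⊥-elim (x≢x refl)

stepOf-horizontal : ∀ {x x′} y → x ≢ x′ → stepOf (x , y) (x′ , y) ≡ step x x′ y
stepOf-horizontal {x} {x′} y x≢x′ with x ≟ x′
... | yes x≡x′ = ⊥-elim (x≢x′ x≡x′)
... | no  _    = refl

stepOf-move : ∀ o {p q x} → p < q → (mv : Move o p q x) → stepOf (point o p q) x ≡ moveStep mv
stepOf-move true  {p}     p<q (raise q<y)     = stepOf-vertical p _ _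
stepOf-move false {p}     p<q (raise q<y)     = stepOf-horizontal p (<⇒≢ q<y)
stepOf-move true  {q = q} p<q (overtake q<y)  = stepOf-horizontal q (<⇒≢ (<-trans p<q q<y))
stepOf-move false {q = q} p<q (overtake q<y)  = stepOf-vertical q _ _
stepOf-move true  {q = q} p<q (advance p<y _) = stepOf-horizontal q (<⇒≢ p<y)
stepOf-move false {q = q} p<q (advance p<y _) = stepOf-vertical q _ _

finish : ℕ → ℕ → List (List Point)
finish zero    zero    = [ [] ]
finish zero    (suc _) = []
finish (suc _) _       = []

∈-finish⁻ : ∀ {a b xs} → xs ∈ finish a b → a ≡ 0 × b ≡ 0 × xs ≡ []
∈-finish⁻ {zero} {zero} (here refl) = refl , refl , refl

[]∈finish : ∀ {a b} → a ≡ 0 → b ≡ 0 → [] ∈ finish a b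
[]∈finish refl refl = here refl

-- paths μ o a b p m q lists the continuations from point o p q in mode μ with threshold m,
-- where a = n ∸ q and b = q ∸ m serve as recursion fuel.
mutual
  paths : Mode → Bool → (a b p m q : ℕ) → List (List Point)
  paths μ o a b p m q = map (point o p q ∷_) (branches μ o a b p m q)

  branches : Mode → Bool → (a b p m q : ℕ) → List (List Point)
  branches μ o a b p m q =
    finish a b ++ ifFree μ (freeAbove a 1 o p q q) [] ++ freeAbove a 0 (not o) q (suc q) q ++ lockedBelow a b o m q

  freeAbove : (a b : ℕ) → Bool → (p m q : ℕ) → List (List Point)
  freeAbove zero    b o p m q = []
  freeAbove (suc a) b o p m q = paths free o a b p m (suc q) ++ freeAbove a (suc b) o p m (suc q)

  lockedBelow : (a k : ℕ) → Bool → (y q : ℕ) → List (List Point)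
  lockedBelow a zero    o y q = []
  lockedBelow a (suc k) o y q = paths locked o a k y (suc y) q ++ lockedBelow a k o (suc y) q

Branch : Mode → Bool → (a b p m q : ℕ) → List Point → Set
Branch μ o a b p m q xs =
  xs ∈ finish a b ⊎ (μ ≡ free × xs ∈ freeAbove a 1 o p q q) ⊎
  xs ∈ freeAbove a 0 (not o) q (suc q) q ⊎ xs ∈ lockedBelow a b o m q

∈-branches⁻ : ∀ μ o a b p m q {xs} → xs ∈ branches μ o a b p m q → Branch μ o a b p m q xs
∈-branches⁻ μ o a b p m q xs∈ with ∈-++⁻ (finish a b) xs∈
... | inj₁ xs∈F = inj₁ xs∈F
... | inj₂ xs∈RJD with μ | ∈-++⁻ (ifFree μ (freeAbove a 1 o p q q) []) xs∈RJD
...   | free   | inj₁ xs∈R  = inj₂ (inj₁ (refl , xs∈R))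
...   | locked | inj₁ ()
...   | _      | inj₂ xs∈JD = inj₂ (inj₂ (∈-++⁻ (freeAbove a 0 (not o) q (suc q) q) xs∈JD))

∈-branches⁺ : ∀ μ o a b p m q {xs} → Branch μ o a b p m q xs → xs ∈ branches μ o a b p m q
∈-branches⁺ μ    o a b p m q (inj₁ xs∈F)                 = ∈-++⁺ˡ xs∈F
∈-branches⁺ free o a b p m q (inj₂ (inj₁ (refl , xs∈R))) = ∈-++⁺ʳ (finish a b) (∈-++⁺ˡ xs∈R)
∈-branches⁺ μ    o a b p m q (inj₂ (inj₂ xs∈JD))         =
  ∈-++⁺ʳ (finish a b) (∈-++⁺ʳ (ifFree μ (freeAbove a 1 o p q q) [])
    (Sum.[ ∈-++⁺ˡ , ∈-++⁺ʳ (freeAbove a 0 (not o) q (suc q) q) ] xs∈JD))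

paths-heads : ∀ μ o a b p m q → All (StartsWith (_≡ point o p q)) (paths μ o a b p m q)
paths-heads μ o a b p m q = All.map⁺ (All.universal (λ _ → refl) _)

freeAbove-heads : ∀ a b o p m q → All (StartsWith (Above o p q)) (freeAbove a b o p m q)
freeAbove-heads zero    b o p m q = []
freeAbove-heads (suc a) b o p m q = All.++⁺
  (all-startsWith-map (paths-heads free o a b p m (suc q)) λ { refl → suc q , ≤-refl , refl })
  (all-startsWith-map (freeAbove-heads a (suc b) o p m (suc q)) λ { (y , q<y , eq) → y , <-trans (n<1+n q) q<y , eq })

lockedBelow-heads : ∀ a k o y q → y + k ≡ q → All (StartsWith (Below o y q)) (lockedBelow a k o y q)
lockedBelow-heads a zero    o y q y+k≡q = []
lockedBelow-heads a (suc k) o y q y+k≡q = All.++⁺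
  (all-startsWith-map (paths-heads locked o a k y (suc y) q)
    λ { refl → y , ≤-refl , subst (y <_) y+k≡q (m<m+n y (s≤s z≤n)) , refl })
  (all-startsWith-map (lockedBelow-heads a k o (suc y) q (trans (sym (+-suc y k)) y+k≡q))
    λ { (y′ , y<y′ , y′<q , eq) → y′ , <⇒≤ y<y′ , y′<q , eq })

finish-disjoint : ∀ μ o a b p m q → Disjoint (finish a b)
  (ifFree μ (freeAbove a 1 o p q q) [] ++ freeAbove a 0 (not o) q (suc q) q ++ lockedBelow a b o m q)
finish-disjoint free   o zero    zero    p m q (_ , ())
finish-disjoint locked o zero    zero    p m q (_ , ())
finish-disjoint μ      o zero    (suc b) p m q (() , _)
finish-disjoint μ      o (suc a) b       p m q (() , _)

unique-finish : ∀ a b → Unique (finish a b)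
unique-finish zero    zero    = [] ∷ []
unique-finish zero    (suc b) = []
unique-finish (suc a) b       = []

mutual
  unique-paths : ∀ μ o a b p m q → m + b ≡ q → p < m → Unique (paths μ o a b p m q)
  unique-paths μ o a b p m q m+b≡q p<m = Unique.map⁺ ∷-injectiveʳ
    (Unique.++⁺ (unique-finish a b)
      (Unique.++⁺ (unique-ifFree μ (unique-freeAbove a 1 o p q q (+-comm q 1) p<q))
        (Unique.++⁺ (unique-freeAbove a 0 (not o) q (suc q) q (+-identityʳ (suc q)) ≤-refl)
                    (unique-lockedBelow a b o m q m+b≡q)
                    (disjoint-by-start overtakes advances (above-disjoint-below ≤-refl)))
        (disjoint-++ʳ (disjoint-by-start raises overtakes (above-disjoint-above p<q))
                      (disjoint-by-start raises advances (above-disjoint-below (<⇒≤ p<q)))))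
      (finish-disjoint μ o a b p m q))
    where
      p<q = <-≤-trans p<m (subst (m ≤_) m+b≡q (m≤m+n m b))
      raises    = all-ifFree μ (freeAbove-heads a 1 o p q q)
      overtakes = freeAbove-heads a 0 (not o) q (suc q) q
      advances  = lockedBelow-heads a b o m q m+b≡q

  unique-freeAbove : ∀ a b o p m q → m + b ≡ suc q → p < m → Unique (freeAbove a b o p m q)
  unique-freeAbove zero    b o p m q m+b≡q p<m = []
  unique-freeAbove (suc a) b o p m q m+b≡q p<m = Unique.++⁺
    (unique-paths free o a b p m (suc q) m+b≡q p<m)
    (unique-freeAbove a (suc b) o p m (suc q) (trans (+-suc m b) (cong suc m+b≡q)) p<m)
    (disjoint-by-start (paths-heads free o a b p m (suc q)) (freeAbove-heads a (suc b) o p m (suc q))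
      λ { refl (y , q<y , eq) → <⇒≢ q<y (proj₂ (point-injective o o p≤q (≤-trans p≤q (<⇒≤ q<y)) eq)) })
    where p≤q = ≤-trans (<⇒≤ p<m) (subst (m ≤_) m+b≡q (m≤m+n m b))

  unique-lockedBelow : ∀ a k o y q → y + k ≡ q → Unique (lockedBelow a k o y q)
  unique-lockedBelow a zero    o y q y+k≡q = []
  unique-lockedBelow a (suc k) o y q y+k≡q = Unique.++⁺
    (unique-paths locked o a k y (suc y) q 1+y+k≡q (n<1+n y))
    (unique-lockedBelow a k o (suc y) q 1+y+k≡q)
    (disjoint-by-start (paths-heads locked o a k y (suc y) q) (lockedBelow-heads a k o (suc y) q 1+y+k≡q)
      λ { refl (y′ , y<y′ , y′<q , eq) → <⇒≢ y<y′ (proj₁ (point-injective o o y≤q (<⇒≤ y′<q) eq)) })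
    where
      1+y+k≡q = trans (sym (+-suc y k)) y+k≡q
      y≤q = subst (y ≤_) y+k≡q (m≤m+n y (suc k))

mutual
  #paths : Mode → ℕ → ℕ → ℕ
  #paths μ a b = length (finish a b) + (ifFree μ (#freeAbove a 1) 0 + (#freeAbove a 0 + #lockedBelow a b))

  #freeAbove : ℕ → ℕ → ℕ
  #freeAbove zero    b = 0
  #freeAbove (suc a) b = #paths free a b + #freeAbove a (suc b)

  #lockedBelow : ℕ → ℕ → ℕ
  #lockedBelow a zero    = 0
  #lockedBelow a (suc k) = #paths locked a k + #lockedBelow a k

mutual
  length-paths : ∀ μ o a b p m q → length (paths μ o a b p m q) ≡ #paths μ a b
  length-paths μ o a b p m q = begin
    length (map (point o p q ∷_) (F ++ R ++ J ++ D))  ≡⟨ length-map (point o p q ∷_) (F ++ R ++ J ++ D) ⟩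
    length (F ++ R ++ J ++ D)                         ≡⟨ length-++₄ F R J D ⟩
    length F + (length R + (length J + length D))     ≡⟨ cong₂ (λ r k → length F + (r + k)) length-R
                                                           (cong₂ _+_ (length-freeAbove a 0 (not o) q (suc q) q)
                                                                      (length-lockedBelow a b o m q)) ⟩
    #paths μ a b                                      ∎
    where
      open ≡-Reasoning
      F = finish a b
      R = ifFree μ (freeAbove a 1 o p q q) []
      J = freeAbove a 0 (not o) q (suc q) q
      D = lockedBelow a b o m q
      length-R : length R ≡ ifFree μ (#freeAbove a 1) 0
      length-R = trans (ifFree-natural μ length _ []) (cong (λ r → ifFree μ r 0) (length-freeAbove a 1 o p q q))

  length-freeAbove : ∀ a b o p m q → length (freeAbove a b o p m q) ≡ #freeAbove a b
  length-freeAbove zero    b o p m q = refl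
  length-freeAbove (suc a) b o p m q =
    trans (length-++ (paths free o a b p m (suc q)))
          (cong₂ _+_ (length-paths free o a b p m (suc q)) (length-freeAbove a (suc b) o p m (suc q)))

  length-lockedBelow : ∀ a k o y q → length (lockedBelow a k o y q) ≡ #lockedBelow a k
  length-lockedBelow a zero    o y q = refl
  length-lockedBelow a (suc k) o y q =
    trans (length-++ (paths locked o a k y (suc y) q))
          (cong₂ _+_ (length-paths locked o a k y (suc y) q) (length-lockedBelow a k o (suc y) q))

#lockedBelow-zero : ∀ k → #lockedBelow 0 (suc k) ≡ 2 ^ k
#lockedBelow-zero zero    = refl
#lockedBelow-zero (suc k) = begin
  #lockedBelow 0 (suc k) + #lockedBelow 0 (suc k) ≡⟨ cong₂ _+_ (#lockedBelow-zero k) (#lockedBelow-zero k) ⟩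
  2 ^ k + 2 ^ k                                   ≡⟨ cong (2 ^ k +_) (+-identityʳ (2 ^ k)) ⟨
  2 ^ suc k                                       ∎
  where open ≡-Reasoning

#lockedBelow-doubles : ∀ a k → #lockedBelow (suc a) k + #freeAbove (suc a) 0 ≡ 2 ^ k * #freeAbove (suc a) 0
#lockedBelow-doubles a zero    = sym (+-identityʳ (#freeAbove (suc a) 0))
#lockedBelow-doubles a (suc k) = begin
  (J + D) + D + J ≡⟨ regroup J D ⟩
  2 * (D + J)     ≡⟨ cong (2 *_) (#lockedBelow-doubles a k) ⟩
  2 * (2 ^ k * J) ≡⟨ *-assoc 2 (2 ^ k) J ⟨
  2 ^ suc k * J   ∎
  where
    open ≡-Reasoning
    J = #freeAbove (suc a) 0
    D = #lockedBelow (suc a) k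
    regroup : ∀ j d → (j + d) + d + j ≡ 2 * (d + j)
    regroup = solve-∀

#paths-split : ∀ μ a b → #paths μ (suc a) b ≡ ifFree μ (#freeAbove (suc a) 1) 0 + 2 ^ b * #freeAbove (suc a) 0
#paths-split μ a b = cong (ifFree μ (#freeAbove (suc a) 1) 0 +_) (begin
  #freeAbove (suc a) 0 + #lockedBelow (suc a) b ≡⟨ +-comm (#freeAbove (suc a) 0) _ ⟩
  #lockedBelow (suc a) b + #freeAbove (suc a) 0 ≡⟨ #lockedBelow-doubles a b ⟩
  2 ^ b * #freeAbove (suc a) 0                  ∎)
  where open ≡-Reasoning

repunit₄ : ℕ → ℕ
repunit₄ zero    = 0
repunit₄ (suc t) = 1 + 4 * repunit₄ t

3*repunit₄+1 : ∀ t → 3 * repunit₄ t + 1 ≡ 4 ^ t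
3*repunit₄+1 zero    = refl
3*repunit₄+1 (suc t) = begin
  3 * (1 + 4 * repunit₄ t) + 1 ≡⟨ regroup (repunit₄ t) ⟩
  4 * (3 * repunit₄ t + 1)     ≡⟨ cong (4 *_) (3*repunit₄+1 t) ⟩
  4 * 4 ^ t                    ∎
  where
    open ≡-Reasoning
    regroup : ∀ r → 3 * (1 + 4 * r) + 1 ≡ 4 * (3 * r + 1)
    regroup = solve-∀

#freeAbove-closed : ∀ t b → #freeAbove (2 + t) b ≡ 2 * 2 ^ b + 1 + 5 * repunit₄ t * (2 ^ b + 1)
#freeAbove-closed zero b = begin
  #paths free 1 b + (#paths free 0 (suc b) + 0)
    ≡⟨ cong₂ (λ u v → u + (v + 0)) (#paths-split free 0 b) (#lockedBelow-zero b) ⟩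
  1 + 2 ^ b * 1 + (2 ^ b + 0)
    ≡⟨ collect (2 ^ b) ⟩
  2 * 2 ^ b + 1 + 5 * 0 * (2 ^ b + 1)
    ∎
  where
    open ≡-Reasoning
    collect : ∀ x → 1 + x * 1 + (x + 0) ≡ 2 * x + 1 + 5 * 0 * (x + 1)
    collect = solve-∀
#freeAbove-closed (suc t) b = begin
  #paths free (2 + t) b + #freeAbove (2 + t) (suc b)
    ≡⟨ cong (_+ #freeAbove (2 + t) (suc b)) (#paths-split free (suc t) b) ⟩
  #freeAbove (2 + t) 1 + 2 ^ b * #freeAbove (2 + t) 0 + #freeAbove (2 + t) (suc b)
    ≡⟨ substitute (2 ^ b) (repunit₄ t) (#freeAbove-closed t 1) (#freeAbove-closed t 0) (#freeAbove-closed t (suc b)) ⟩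
  2 * 2 ^ b + 1 + 5 * repunit₄ (suc t) * (2 ^ b + 1)
    ∎
  where
    open ≡-Reasoning
    collect : ∀ x r → 2 * 2 + 1 + 5 * r * (2 + 1) + x * (2 * 1 + 1 + 5 * r * (1 + 1)) +
                      (2 * (2 * x) + 1 + 5 * r * (2 * x + 1)) ≡ 2 * x + 1 + 5 * (1 + 4 * r) * (x + 1)
    collect = solve-∀
    substitute : ∀ {A B C} x r → A ≡ 2 * 2 + 1 + 5 * r * (2 + 1) → B ≡ 2 * 1 + 1 + 5 * r * (1 + 1) →
                 C ≡ 2 * (2 * x) + 1 + 5 * r * (2 * x + 1) → A + x * B + C ≡ 2 * x + 1 + 5 * (1 + 4 * r) * (x + 1)
    substitute x r refl refl refl = collect x r

#paths-closed : ∀ t → 3 * #paths free (2 + t) 0 + 1 ≡ 25 * 4 ^ t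
#paths-closed t = begin
  3 * #paths free (2 + t) 0 + 1                             ≡⟨ cong (λ u → 3 * u + 1) (#paths-split free (suc t) 0) ⟩
  3 * (#freeAbove (2 + t) 1 + 1 * #freeAbove (2 + t) 0) + 1 ≡⟨ substitute (repunit₄ t) (#freeAbove-closed t 1)
                                                                                      (#freeAbove-closed t 0) ⟩
  25 * (3 * repunit₄ t + 1)                                 ≡⟨ cong (25 *_) (3*repunit₄+1 t) ⟩
  25 * 4 ^ t                                                ∎
  where
    open ≡-Reasoning
    collect : ∀ r → 3 * (2 * 2 + 1 + 5 * r * (2 + 1) + 1 * (2 * 1 + 1 + 5 * r * (1 + 1))) + 1 ≡ 25 * (3 * r + 1)
    collect = solve-∀
    substitute : ∀ {A B} r → A ≡ 2 * 2 + 1 + 5 * r * (2 + 1) → B ≡ 2 * 1 + 1 + 5 * r * (1 + 1) →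
                 3 * (A + 1 * B) + 1 ≡ 25 * (3 * r + 1)
    substitute r refl refl = collect r

module Enumeration (n : ℕ) where

  Terminal : Point → Set
  Terminal x = x ≡ (n ∸ 1 , n) ⊎ x ≡ (n , n ∸ 1)

  EndsTerminal : List Point → Set
  EndsTerminal ps = last ps ≡ just (n ∸ 1 , n) ⊎ last ps ≡ just (n , n ∸ 1)

  -- x ∷ xs is the end of a coherent lattice path whose earlier steps are pre, most recent first.
  Continuation : List Step → Point → List Point → Set
  Continuation pre x []        = GoodPoint n x × Terminal x
  Continuation pre x (x′ ∷ xs) =
    GoodPoint n x × ValidMove x x′ × Allowed pre (Step.src t) (Step.fixed t) × Continuation (t ∷ pre) x′ xs
    where t = stepOf x x′

  Extends : List Step → Point → List Point → Set
  Extends pre x ps = ∃[ xs ] ps ≡ x ∷ xs × Continuation pre x xs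

  continuation-head : ∀ {pre x} xs → Continuation pre x xs → GoodPoint n x
  continuation-head []      (g , _) = g
  continuation-head (_ ∷ _) (g , _) = g

  continuation⇒ : ∀ {pre x} xs → Continuation pre x xs →
                  EndsTerminal (x ∷ xs) × All (GoodPoint n) (x ∷ xs) × Linked ValidMove (x ∷ xs) ×
                  AllPrior Compatible pre (steps (x ∷ xs))
  continuation⇒ []       (g , terminal)  = Sum.map (cong just) (cong just) terminal , g ∷ [] , [-] , tt
  continuation⇒ (_ ∷ xs) (g , v , φ , c) with continuation⇒ xs c
  ... | terminal , gs , linked , prior = terminal , g ∷ gs , v ∷ linked , φ , prior

  ⇒continuation : ∀ {pre x} xs → EndsTerminal (x ∷ xs) → All (GoodPoint n) (x ∷ xs) → Linked ValidMove (x ∷ xs) →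
                  AllPrior Compatible pre (steps (x ∷ xs)) → Continuation pre x xs
  ⇒continuation []       terminal (g ∷ []) _            _           =
    g , Sum.map just-injective just-injective terminal
  ⇒continuation (_ ∷ xs) terminal (g ∷ gs) (v ∷ linked) (φ , prior) =
    g , v , φ , ⇒continuation xs terminal gs linked prior

  coherentLatticePath⇔ : ∀ {x} xs → CoherentLatticePath n (x ∷ xs) ⇔ (x ≡ (2 , 1) × Continuation [] x xs)
  coherentLatticePath⇔ {x} xs = mk⇔
    (λ { ((start , terminal , gs , linked) , coh) →
           just-injective start , ⇒continuation xs terminal gs linked (coherent⇒allPrior (x ∷ xs) coh) })
    (λ { (refl , c) → let (terminal , gs , linked , prior) = continuation⇒ xs c in
           (refl , terminal , gs , linked) , allPrior⇒coherent (x ∷ xs) prior })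

  good-point : ∀ o {p q} → 1 ≤ p → p < q → q ≤ n → GoodPoint n (point o p q)
  good-point true  1≤p p<q q≤n = (1≤p , ≤-trans (<⇒≤ p<q) q≤n) , (≤-trans 1≤p (<⇒≤ p<q) , q≤n) , <⇒≢ p<q
  good-point false 1≤p p<q q≤n = (≤-trans 1≤p (<⇒≤ p<q) , q≤n) , (1≤p , ≤-trans (<⇒≤ p<q) q≤n) , >⇒≢ p<q

  larger≤n : ∀ o {p q} → GoodPoint n (point o p q) → q ≤ n
  larger≤n true  (_ , (_ , q≤n) , _) = q≤n
  larger≤n false ((_ , q≤n) , _ , _) = q≤n

  distinct : ∀ {x} → GoodPoint n x → proj₁ x ≢ proj₂ x
  distinct (_ , _ , x≢y) = x≢y

  terminal-point⁺ : ∀ o {p q} → suc p ≡ n → q ≡ n → Terminal (point o p q)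
  terminal-point⁺ true  1+p≡n q≡n = inj₁ (cong₂ _,_ (cong (_∸ 1) 1+p≡n) q≡n)
  terminal-point⁺ false 1+p≡n q≡n = inj₂ (cong₂ _,_ q≡n (cong (_∸ 1) 1+p≡n))

  terminal-point⁻ : ∀ o {p q} → p < q → Terminal (point o p q) → suc p ≡ n × q ≡ n
  terminal-point⁻ true  n∸1<n (inj₁ refl) = m+[n∸m]≡n (≤-trans (s≤s z≤n) n∸1<n) , refl
  terminal-point⁻ true  n<n∸1 (inj₂ refl) = ⊥-elim (≤⇒≯ (m∸n≤m n 1) n<n∸1)
  terminal-point⁻ false n<n∸1 (inj₁ refl) = ⊥-elim (≤⇒≯ (m∸n≤m n 1) n<n∸1)
  terminal-point⁻ false n∸1<n (inj₂ refl) = m+[n∸m]≡n (≤-trans (s≤s z≤n) n∸1<n) , refl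

  continuation-move⁻ : ∀ o {p q x xs pre} → p < q → (mv : Move o p q x) → Continuation pre (point o p q) (x ∷ xs) →
                       Allowed pre (Step.src (moveStep mv)) (Step.fixed (moveStep mv)) ×
                       Continuation (moveStep mv ∷ pre) x xs
  continuation-move⁻ o p<q mv (_ , _ , φ , c) rewrite stepOf-move o p<q mv = φ , c

  continuation-move⁺ : ∀ o {p q x xs pre} → p < q → (mv : Move o p q x) → GoodPoint n (point o p q) →
                       Allowed pre (Step.src (moveStep mv)) (Step.fixed (moveStep mv)) →
                       Continuation (moveStep mv ∷ pre) x xs → Continuation pre (point o p q) (x ∷ xs)
  continuation-move⁺ o p<q mv g φ c rewrite stepOf-move o p<q mv = g , validMove o p<q mv , φ , c

  ¬continuation-blocked : ∀ o {p q pre} xs → suc p < n → p < q → Blocked pre p q → ¬ Continuation pre (point o p q) xs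
  ¬continuation-blocked o []       1+p<n p<q blocked (_ , terminal) =
    <⇒≢ 1+p<n (proj₁ (terminal-point⁻ o p<q terminal))
  ¬continuation-blocked o (x ∷ xs) 1+p<n p<q blocked c@(_ , v , _ , c′)
    with move o p<q v (distinct (continuation-head xs c′))
  ... | raise q<y       = ¬continuation-blocked o xs 1+p<n (<-trans p<q q<y) (blocked-∷ _ (<⇒≤ q<y) blocked)
                                                (proj₂ (continuation-move⁻ o p<q (raise q<y) c))
  ... | overtake q<y    = blocked _ ≤-refl (proj₁ (continuation-move⁻ o p<q (overtake q<y) c))
  ... | advance p<y y<q = blocked _ ≤-refl (proj₁ (continuation-move⁻ o p<q (advance p<y y<q) c))

  record Bounds (a b p m q : ℕ) : Set where
    field
      q+a≡n     : q + a ≡ n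
      m+b≡q     : m + b ≡ q
      1≤p       : 1 ≤ p
      p<m       : p < m
      b≡0⇒m≡1+p : b ≡ 0 → m ≡ suc p

    p<q : p < q
    p<q = <-≤-trans p<m (subst (m ≤_) m+b≡q (m≤m+n m b))

    q≤n : q ≤ n
    q≤n = subst (q ≤_) q+a≡n (m≤m+n q a)

    good : ∀ o → GoodPoint n (point o p q)
    good o = good-point o 1≤p p<q q≤n

  bounds-raised : ∀ {a b p m q} → q + suc a ≡ n → m + b ≡ suc q → 1 ≤ p → p < m → (b ≡ 0 → m ≡ suc p) →
                  Bounds a b p m (suc q)
  bounds-raised {a} {q = q} q+a≡n m+b≡q 1≤p p<m b≡0⇒m≡1+p = record
    { q+a≡n = trans (sym (+-suc q a)) q+a≡n ; m+b≡q = m+b≡q ; 1≤p = 1≤p ; p<m = p<m ; b≡0⇒m≡1+p = b≡0⇒m≡1+p }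

  bounds-locked : ∀ {a k y q} → q + a ≡ n → y + suc k ≡ q → 1 ≤ y → Bounds a k y (suc y) q
  bounds-locked {k = k} {y} q+a≡n y+k≡q 1≤y = record
    { q+a≡n = q+a≡n ; m+b≡q = trans (sym (+-suc y k)) y+k≡q ; 1≤p = 1≤y ; p<m = ≤-refl ; b≡0⇒m≡1+p = λ _ → refl }

  mutual
    paths-sound : ∀ {μ o a b p m q pre ps} → Bounds a b p m q → Invariant μ p q m pre →
                  ps ∈ paths μ o a b p m q → Extends pre (point o p q) ps
    paths-sound {o = o} {p = p} {q = q} B I ps∈ with ∈-map⁻ (point o p q ∷_) ps∈
    ... | xs , xs∈ , refl = xs , refl , branches-sound B I xs∈

    branches-sound : ∀ {μ o a b p m q pre xs} → Bounds a b p m q → Invariant μ p q m pre →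
                     xs ∈ branches μ o a b p m q → Continuation pre (point o p q) xs
    branches-sound {μ} {o} {a} {b} {p} {m} {q} B I xs∈ with ∈-branches⁻ μ o a b p m q xs∈
    ... | inj₁ xs∈F                 = finish-sound B xs∈F
    ... | inj₂ (inj₁ (refl , xs∈R)) = raise-sound B I xs∈R
    ... | inj₂ (inj₂ (inj₁ xs∈J))   = overtake-sound B I xs∈J
    ... | inj₂ (inj₂ (inj₂ xs∈D))   = advance-sound B I xs∈D

    finish-sound : ∀ {o a b p m q pre xs} → Bounds a b p m q → xs ∈ finish a b → Continuation pre (point o p q) xs
    finish-sound {o} {p = p} {m} {q} B xs∈ with ∈-finish⁻ xs∈
    ... | refl , refl , refl = good o , terminal-point⁺ o 1+p≡n q≡n
      where
        open Bounds B
        q≡n = trans (sym (+-identityʳ q)) q+a≡n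
        1+p≡n = trans (sym (b≡0⇒m≡1+p refl)) (trans (sym (+-identityʳ m)) (trans m+b≡q q≡n))

    raise-sound : ∀ {o a b p m q pre xs} → Bounds a b p m q → Invariant free p q m pre →
                  xs ∈ freeAbove a 1 o p q q → Continuation pre (point o p q) xs
    raise-sound {o} {p = p} {q = q} B I xs∈
      with freeAbove-sound q+a≡n (+-comm q 1) 1≤p p<q (λ ()) (λ q<y → invariant-raise I p<q q<y) xs∈
      where open Bounds B
    ... | y , q<y , xs′ , refl , c = continuation-move⁺ o p<q (raise q<y) (good o) (Invariant.large I q p ≤-refl) c
      where open Bounds B

    overtake-sound : ∀ {μ o a b p m q pre xs} → Bounds a b p m q → Invariant μ p q m pre →
                     xs ∈ freeAbove a 0 (not o) q (suc q) q → Continuation pre (point o p q) xs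
    overtake-sound {o = o} {p = p} {q = q} B I xs∈
      with freeAbove-sound q+a≡n (+-identityʳ (suc q)) (≤-trans 1≤p (<⇒≤ p<q)) ≤-refl (λ _ → refl)
                           (invariant-overtake I) xs∈
      where open Bounds B
    ... | y , q<y , xs′ , refl , c = continuation-move⁺ o p<q (overtake q<y) (good o) (Invariant.small I) c
      where open Bounds B

    advance-sound : ∀ {μ o a b p m q pre xs} → Bounds a b p m q → Invariant μ p q m pre →
                    xs ∈ lockedBelow a b o m q → Continuation pre (point o p q) xs
    advance-sound {o = o} {p = p} {m} {q} B I xs∈
      with lockedBelow-sound q+a≡n m+b≡q (≤-trans 1≤p (<⇒≤ p<m))
                             (λ m≤y y<q → invariant-advance I (<-≤-trans p<m m≤y) y<q m≤y) xs∈
      where open Bounds B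
    ... | y , m≤y , y<q , xs′ , refl , c =
      continuation-move⁺ o p<q (advance (<-≤-trans p<m m≤y) y<q) (good o) (Invariant.small I) c
      where open Bounds B

    freeAbove-sound : ∀ {a b o p m q ps} {P : ℕ → List Step} → q + a ≡ n → m + b ≡ suc q → 1 ≤ p → p < m →
                      (b ≡ 0 → m ≡ suc p) → (∀ {y} → q < y → Invariant free p y m (P y)) →
                      ps ∈ freeAbove a b o p m q → ∃[ y ] q < y × Extends (P y) (point o p y) ps
    freeAbove-sound {suc a} {b} {o} {p} {m} {q} q+a≡n m+b≡q 1≤p p<m b≡0⇒m≡1+p I ps∈
      with ∈-++⁻ (paths free o a b p m (suc q)) ps∈
    ... | inj₁ ps∈first =
      suc q , ≤-refl , paths-sound (bounds-raised q+a≡n m+b≡q 1≤p p<m b≡0⇒m≡1+p) (I ≤-refl) ps∈first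
    ... | inj₂ ps∈rest
      with freeAbove-sound (trans (sym (+-suc q a)) q+a≡n) (trans (+-suc m b) (cong suc m+b≡q)) 1≤p p<m (λ ())
                           (λ 1+q<y → I (<-trans (n<1+n q) 1+q<y)) ps∈rest
    ...   | y , 1+q<y , extends = y , <-trans (n<1+n q) 1+q<y , extends

    lockedBelow-sound : ∀ {a k o y₀ q ps} {P : ℕ → List Step} → q + a ≡ n → y₀ + k ≡ q → 1 ≤ y₀ →
                        (∀ {y} → y₀ ≤ y → y < q → Invariant locked y q (suc y) (P y)) →
                        ps ∈ lockedBelow a k o y₀ q → ∃[ y ] y₀ ≤ y × y < q × Extends (P y) (point o y q) ps
    lockedBelow-sound {a} {suc k} {o} {y₀} {q} q+a≡n y₀+k≡q 1≤y₀ I ps∈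
      with ∈-++⁻ (paths locked o a k y₀ (suc y₀) q) ps∈
    ... | inj₁ ps∈first =
      y₀ , ≤-refl , y₀<q , paths-sound (bounds-locked q+a≡n y₀+k≡q 1≤y₀) (I ≤-refl y₀<q) ps∈first
      where y₀<q = subst (y₀ <_) y₀+k≡q (m<m+n y₀ (s≤s z≤n))
    ... | inj₂ ps∈rest
      with lockedBelow-sound q+a≡n (trans (sym (+-suc y₀ k)) y₀+k≡q) (s≤s z≤n)
                             (λ 1+y₀≤y → I (≤-trans (n≤1+n y₀) 1+y₀≤y)) ps∈rest
    ...   | y , 1+y₀≤y , y<q , extends = y , ≤-trans (n≤1+n y₀) 1+y₀≤y , y<q , extends

  advance-bound : ∀ {p m q y} b → m + b ≡ q → q ≤ n → (b ≡ 0 → m ≡ suc p) → p < y → y < m → suc y < n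
  advance-bound zero            _     _   b≡0⇒m≡1+p p<y y<m =
    ⊥-elim (≤⇒≯ (≤-pred (subst (_ <_) (b≡0⇒m≡1+p refl) y<m)) p<y)
  advance-bound {m = m} (suc b) m+b≡q q≤n _         _   y<m = ≤-trans (s≤s y<m) (≤-trans m<q q≤n)
    where m<q = subst (m <_) m+b≡q (m<m+n m (s≤s z≤n))

  mutual
    paths-complete : ∀ {μ o a b p m q pre} xs → Bounds a b p m q → Invariant μ p q m pre →
                     Continuation pre (point o p q) xs → point o p q ∷ xs ∈ paths μ o a b p m q
    paths-complete {μ} {o} {a} {b} {p} {m} {q} xs B I c =
      ∈-map⁺ (point o p q ∷_) (∈-branches⁺ μ o a b p m q (branch-complete xs B I c))

    branch-complete : ∀ {μ o a b p m q pre} xs → Bounds a b p m q → Invariant μ p q m pre →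
                      Continuation pre (point o p q) xs → Branch μ o a b p m q xs
    branch-complete {o = o} {a} {b} {p} {m} {q} [] B I (_ , terminal) = inj₁ ([]∈finish a≡0 b≡0)
      where
        open Bounds B
        ends = terminal-point⁻ o p<q terminal
        a≡0 = +-cancelˡ-≡ q a 0 (trans q+a≡n (trans (sym (proj₂ ends)) (sym (+-identityʳ q))))
        q≤m = subst (_≤ m) (trans (proj₁ ends) (sym (proj₂ ends))) p<m
        b≡0 = n≤0⇒n≡0 (+-cancelˡ-≤ m b 0 (≤-trans (≤-reflexive m+b≡q)
                                                  (≤-trans q≤m (≤-reflexive (sym (+-identityʳ m))))))
    branch-complete {o = o} (x ∷ xs) B I c@(_ , v , _ , c′)
      with move o (Bounds.p<q B) v (distinct (continuation-head xs c′))
    ... | raise q<y       = raise-complete xs B I q<y c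
    ... | overtake q<y    = inj₂ (inj₂ (inj₁ (overtake-complete xs B I q<y c)))
    ... | advance p<y y<q = advance-complete xs B I p<y y<q c

    raise-complete : ∀ {μ o a b p m q y pre} xs → Bounds a b p m q → Invariant μ p q m pre → q < y →
                     Continuation pre (point o p q) (point o p y ∷ xs) → Branch μ o a b p m q (point o p y ∷ xs)
    raise-complete {free} {o} xs B I q<y c = inj₂ (inj₁ (refl ,
      freeAbove-complete xs q+a≡n (+-comm _ 1) 1≤p p<q (λ ()) (invariant-raise I p<q q<y) q<y
                         (proj₂ (continuation-move⁻ o p<q (raise q<y) c))))
      where open Bounds B
    raise-complete {locked} {o} xs B I q<y c =
      ⊥-elim (¬continuation-blocked o xs 1+p<n (<-trans p<q q<y) (blocked-raise I q<y) tail)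
      where
        open Bounds B
        tail = proj₂ (continuation-move⁻ o p<q (raise q<y) c)
        1+p<n = ≤-trans (s≤s p<q) (≤-trans q<y (larger≤n o (continuation-head xs tail)))

    overtake-complete : ∀ {μ o a b p m q y pre} xs → Bounds a b p m q → Invariant μ p q m pre → q < y →
                        Continuation pre (point o p q) (point (not o) q y ∷ xs) →
                        point (not o) q y ∷ xs ∈ freeAbove a 0 (not o) q (suc q) q
    overtake-complete {o = o} {q = q} xs B I q<y c =
      freeAbove-complete xs q+a≡n (+-identityʳ (suc q)) (≤-trans 1≤p (<⇒≤ p<q)) ≤-refl (λ _ → refl)
                         (invariant-overtake I q<y) q<y (proj₂ (continuation-move⁻ o p<q (overtake q<y) c))
      where open Bounds B

    advance-complete : ∀ {μ o a b p m q y pre} xs → Bounds a b p m q → Invariant μ p q m pre → p < y → y < q →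
                       Continuation pre (point o p q) (point o y q ∷ xs) → Branch μ o a b p m q (point o y q ∷ xs)
    advance-complete {o = o} {b = b} {m = m} {y = y} xs B I p<y y<q c with m ≤? y
    ... | yes m≤y = inj₂ (inj₂ (inj₂
      (lockedBelow-complete xs q+a≡n m+b≡q m≤y y<q (≤-trans 1≤p (<⇒≤ p<y)) (invariant-advance I p<y y<q m≤y) tail)))
      where
        open Bounds B
        tail = proj₂ (continuation-move⁻ o p<q (advance p<y y<q) c)
    ... | no m≰y = ⊥-elim (¬continuation-blocked o xs (advance-bound b m+b≡q q≤n b≡0⇒m≡1+p p<y (≰⇒> m≰y)) y<q
                                                 (blocked-advance I p<y y<q (≰⇒> m≰y)) tail)
      where
        open Bounds B
        tail = proj₂ (continuation-move⁻ o p<q (advance p<y y<q) c)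

    freeAbove-complete : ∀ {a b o p m q y pre} xs → q + a ≡ n → m + b ≡ suc q → 1 ≤ p → p < m →
                         (b ≡ 0 → m ≡ suc p) → Invariant free p y m pre → q < y → Continuation pre (point o p y) xs →
                         point o p y ∷ xs ∈ freeAbove a b o p m q
    freeAbove-complete {zero} {o = o} {q = q} xs q+0≡n _ _ _ _ _ q<y c =
      ⊥-elim (≤⇒≯ (subst (_ ≤_) (sym (trans (sym (+-identityʳ q)) q+0≡n)) (larger≤n o (continuation-head xs c)))
                  q<y)
    freeAbove-complete {suc a} {b} {o} {p} {m} {q} {y} xs q+a≡n m+b≡q 1≤p p<m b≡0⇒m≡1+p I q<y c
      with y ≟ suc q
    ... | yes refl = ∈-++⁺ˡ (paths-complete xs (bounds-raised q+a≡n m+b≡q 1≤p p<m b≡0⇒m≡1+p) I c)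
    ... | no y≢1+q = ∈-++⁺ʳ (paths free o a b p m (suc q))
      (freeAbove-complete xs (trans (sym (+-suc q a)) q+a≡n) (trans (+-suc m b) (cong suc m+b≡q)) 1≤p p<m (λ ()) I
                          (≤∧≢⇒< q<y (y≢1+q ∘ sym)) c)

    lockedBelow-complete : ∀ {a k o y₀ q y pre} xs → q + a ≡ n → y₀ + k ≡ q → y₀ ≤ y → y < q → 1 ≤ y →
                           Invariant locked y q (suc y) pre → Continuation pre (point o y q) xs →
                           point o y q ∷ xs ∈ lockedBelow a k o y₀ q
    lockedBelow-complete {k = zero} {y₀ = y₀} xs _ y₀+0≡q y₀≤y y<q _ _ _ =
      ⊥-elim (≤⇒≯ (subst (_≤ _) (trans (sym (+-identityʳ y₀)) y₀+0≡q) y₀≤y) y<q)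
    lockedBelow-complete {a} {suc k} {o} {y₀} {q} {y} xs q+a≡n y₀+k≡q y₀≤y y<q 1≤y I c with y ≟ y₀
    ... | yes refl = ∈-++⁺ˡ (paths-complete xs (bounds-locked q+a≡n y₀+k≡q 1≤y) I c)
    ... | no y≢y₀  = ∈-++⁺ʳ (paths locked o a k y₀ (suc y₀) q)
      (lockedBelow-complete xs q+a≡n (trans (sym (+-suc y₀ k)) y₀+k≡q) (≤∧≢⇒< y₀≤y (y≢y₀ ∘ sym)) y<q 1≤y I c)

  coherentPaths : List (List Point)
  coherentPaths = paths free false (n ∸ 2) 0 1 2 2

  bounds-start : 2 ≤ n → Bounds (n ∸ 2) 0 1 2 2
  bounds-start 2≤n = record
    { q+a≡n = m+[n∸m]≡n 2≤n ; m+b≡q = refl ; 1≤p = s≤s z≤n ; p<m = ≤-refl ; b≡0⇒m≡1+p = λ _ → refl }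

  coherentPaths-sound : 2 ≤ n → ∀ {ps} → ps ∈ coherentPaths → CoherentLatticePath n ps
  coherentPaths-sound 2≤n ps∈ with paths-sound (bounds-start 2≤n) invariant-start ps∈
  ... | xs , refl , c = Equivalence.from (coherentLatticePath⇔ xs) (refl , c)

  coherentPaths-complete : 2 ≤ n → ∀ ps → CoherentLatticePath n ps → ps ∈ coherentPaths
  coherentPaths-complete 2≤n []       ((() , _) , _)
  coherentPaths-complete 2≤n (x ∷ xs) path with Equivalence.to (coherentLatticePath⇔ xs) path
  ... | refl , c = paths-complete xs (bounds-start 2≤n) invariant-start c

  unique-coherentPaths : Unique coherentPaths
  unique-coherentPaths = unique-paths free false (n ∸ 2) 0 1 2 2 refl ≤-refl

open Enumeration using (coherentPaths; coherentPaths-sound; coherentPaths-complete; unique-coherentPaths)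

length-coherentPaths : ∀ t → 3 * length (coherentPaths (4 + t)) + 1 ≡ 25 * 4 ^ t
length-coherentPaths t = trans (cong (λ k → 3 * k + 1) (length-paths free false (2 + t) 0 1 2 2)) (#paths-closed t)

theorem5p2 : (n : ℕ) → 4 ≤ n →
    Σ (List (List Point)) λ L →
      Unique L × (∀ ps → (ps ∈ L) ⇔ CoherentLatticePath n ps) ×
      3 * length L + 1 ≡ 25 * 4 ^ (n ∸ 4)
theorem5p2 (suc (suc (suc (suc t)))) (s≤s (s≤s (s≤s (s≤s z≤n)))) =
  coherentPaths n ,
  unique-coherentPaths n ,
  (λ ps → mk⇔ (coherentPaths-sound n 2≤n) (coherentPaths-complete n 2≤n ps)) ,
  length-coherentPaths t
  where
    n = 4 + t
    2≤n = s≤s (s≤s z≤n)
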